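{- Let $k\ge 1$ and let $G$ be a graph on $2k$ vertices. Then the matching complex $\mathsf{M}(G)$ admits a (simplicial) collapse to a complex of dimension at most $k-2$.
   Context: For a simple graph $G$, $\mathsf{M}(G)$ is the simplicial complex whose vertices are the edges of $G$ and whose faces are the matchings of $G$ (sets of pairwise disjoint edges). -}

module Defs where

open import Level using (Level; suc; zero)
open import Data.Nat as ℕ using (ℕ; _*_; _≤_)
open import Data.Fin as Fin using (Fin)
open import Data.Fin.Subset using (Subset; _∈_; _⊆_; ∣_∣)
open import Data.Sum using (_⊎_)
open import Data.Product using (_×_; _,_; proj₁; proj₂; Σ-syntax; ∃-syntax)
open import Relation.Binary.PropositionalEquality using (_≡_; _≢_)
open import Relation.Binary.Construct.Closure.ReflexiveTransitive using (Star)
open import Function.Definitions using (Injective)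

-- A finite simple graph on vertex set Fin n: its edges are enumerated
-- by Fin m; edge e = (a , b) with a < b (no loops, unordered pair
-- written in increasing order), and distinct indices give distinct
-- edges (no multi-edges).
record Graph (n : ℕ) : Set where
  field
    m         : ℕ
    edge      : Fin m → Fin n × Fin n
    ordered   : ∀ e → proj₁ (edge e) Fin.< proj₂ (edge e)
    injective : Injective _≡_ _≡_ edge
open Graph public

DisjointEdges : ∀ {n} → Fin n × Fin n → Fin n × Fin n → Set
DisjointEdges (a , b) (c , d) = a ≢ c × a ≢ d × b ≢ c × b ≢ d

Complex : ℕ → Set₁
Complex m = Subset m → Set

M : ∀ {n} (G : Graph n) → Complex (m G)
M G σ = ∀ {e f} → e ∈ σ → f ∈ σ → e ≢ f → DisjointEdges (edge G e) (edge G f)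

ElementaryCollapse : ∀ {m} → Complex m → Complex m → Set
ElementaryCollapse {m} K L =
  Σ[ σ ∈ Subset m ] Σ[ τ ∈ Subset m ]
    ( K σ × K τ × σ ⊆ τ × ∣ τ ∣ ≡ ℕ.suc ∣ σ ∣
    × (∀ ρ → K ρ → σ ⊆ ρ → ρ ≡ σ ⊎ ρ ≡ τ)
    × (∀ ρ → (L ρ → K ρ × ρ ≢ σ × ρ ≢ τ) × (K ρ × ρ ≢ σ × ρ ≢ τ → L ρ)) )

Collapses : ∀ {m} → Complex m → Complex m → Set₁
Collapses = Star ElementaryCollapse

-- HasDimAtMostMinus2 K k : dim K ≤ k - 2, i.e. every face σ has
-- dim σ = |σ| - 1 ≤ k - 2, i.e. |σ| + 1 ≤ k.
HasDimAtMostMinus2 : ∀ {m} → Complex m → ℕ → Set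
HasDimAtMostMinus2 K k = ∀ σ → K σ → ℕ.suc ∣ σ ∣ ≤ k

module Submission where

-- Let G be a graph on 2k vertices (k ≥ 1) and fix a vertex v.  Every
-- matching has at most k edges, and the faces of M(G) with exactly k
-- edges are the perfect matchings.  For a perfect matching τ let σ(τ)
-- be τ with its (unique) edge e₀ = {v, w} at v deleted.  Then (σ(τ), τ)
-- is a free pair of M(G): a matching ρ ⊇ σ(τ) can only add edges
-- avoiding every vertex covered by σ(τ), i.e. avoiding V ∖ {v, w}, and
-- the only such edge is e₀.  Distinct perfect matchings give distinct
-- pairs, and no σ(τ) is itself perfect, so all these pairs can be
-- removed one after the other; what remains has no face of size k.

open import Data.Nat as ℕ using (ℕ; zero; suc; _+_; _*_; _≤_)
import Data.Nat.Properties as ℕ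
open import Data.Bool using (Bool; true; false)
import Data.Bool.Properties as Bool
open import Data.Fin as Fin using (Fin; zero; suc)
import Data.Fin.Properties as Fin
open import Data.Fin.Subset
open import Data.Fin.Subset.Properties
open import Data.Vec using ([]; _∷_; tabulate; here; there)
open import Data.Vec.Properties using (≡-dec; lookup∘tabulate; []=⇒lookup; lookup⇒[]=)
open import Data.List as List using (List; []; _∷_; _++_; deduplicate)
open import Data.List.Membership.Propositional using () renaming (_∈_ to _∈ˡ_)
open import Data.List.Membership.Propositional.Properties
  using (∈-map⁺; ∈-++⁺ˡ; ∈-++⁺ʳ; ∈-filter⁺; ∈-filter⁻; ∈-deduplicate⁺; ∈-deduplicate⁻)
open import Data.List.Relation.Unary.Any using () renaming (here to hereˡ)
open import Data.List.Relation.Unary.All as All using (All; []; _∷_)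
open import Data.List.Relation.Unary.Unique.Propositional using (Unique; _∷_)
open import Data.List.Relation.Unary.Unique.DecPropositional.Properties using (deduplicate-!)
open import Data.Product using (_×_; _,_; proj₁; proj₂; Σ-syntax; ∃-syntax)
open import Data.Sum using (_⊎_; inj₁; inj₂)
open import Data.Empty using (⊥-elim)
open import Function using (_∘_; id)
open import Relation.Nullary using (¬_; Dec; yes; no; does)
open import Relation.Nullary.Decidable using (dec-true; decidable-stable; _×-dec_; _⊎-dec_; _→-dec_; ¬?)
open import Relation.Unary using (Decidable)
open import Relation.Binary.PropositionalEquality
open import Relation.Binary.Construct.Closure.ReflexiveTransitive using (ε; _◅_; _◅◅_)

open import Defs

private
  variable
    n s : ℕ

∣p∪q∣≡∣p∣+∣q∣ : (p q : Subset n) → (∀ {x} → x ∈ p → x ∉ q) → ∣ p ∪ q ∣ ≡ ∣ p ∣ + ∣ q ∣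
∣p∪q∣≡∣p∣+∣q∣ []         []         _ = refl
∣p∪q∣≡∣p∣+∣q∣ (true ∷ p) (true ∷ q) d = ⊥-elim (d here here)
∣p∪q∣≡∣p∣+∣q∣ (true ∷ p) (false ∷ q) d = cong suc (∣p∪q∣≡∣p∣+∣q∣ p q (λ i → d (there i) ∘ there))
∣p∪q∣≡∣p∣+∣q∣ (false ∷ p) (true ∷ q) d =
  trans (cong suc (∣p∪q∣≡∣p∣+∣q∣ p q (λ i → d (there i) ∘ there))) (sym (ℕ.+-suc ∣ p ∣ ∣ q ∣))
∣p∪q∣≡∣p∣+∣q∣ (false ∷ p) (false ∷ q) d = ∣p∪q∣≡∣p∣+∣q∣ p q (λ i → d (there i) ∘ there)

∣p∣≡1+∣p-x∣ : (p : Subset n) {x : Fin n} → x ∈ p → ∣ p ∣ ≡ suc ∣ p - x ∣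
∣p∣≡1+∣p-x∣ (true ∷ p)  here      = cong (suc ∘ ∣_∣) (sym (p─⊥≡p p))
∣p∣≡1+∣p-x∣ (true ∷ p)  (there i) = cong suc (∣p∣≡1+∣p-x∣ p i)
∣p∣≡1+∣p-x∣ (false ∷ p) (there i) = ∣p∣≡1+∣p-x∣ p i

x∈p─q⇒x∉q : (p q : Subset n) {x : Fin n} → x ∈ p ─ q → x ∉ q
x∈p─q⇒x∉q (_ ∷ p)    (true ∷ q)  ()        here
x∈p─q⇒x∉q (true ∷ p) (false ∷ q) here      ()
x∈p─q⇒x∉q (_ ∷ p)    (_ ∷ q)     (there i) (there j) = x∈p─q⇒x∉q p q i j

select : {P : Fin n → Set} → Decidable P → Subset n
select P? = tabulate (does ∘ P?)

∈-select⁺ : {P : Fin n → Set} (P? : Decidable P) {x : Fin n} → P x → x ∈ select P?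
∈-select⁺ P? {x} px = lookup⇒[]= x (select P?) (trans (lookup∘tabulate _ x) (dec-true (P? x) px))

∈-select⁻ : {P : Fin n → Set} (P? : Decidable P) {x : Fin n} → x ∈ select P? → P x
∈-select⁻ P? {x} x∈ with P? x | trans (sym (lookup∘tabulate (does ∘ P?) x)) ([]=⇒lookup x∈)
... | yes px | _ = px
... | no _   | ()

allSubsets : (s : ℕ) → List (Subset s)
allSubsets zero    = [] ∷ []
allSubsets (suc s) = List.map (true ∷_) (allSubsets s) ++ List.map (false ∷_) (allSubsets s)

∈-allSubsets : (p : Subset s) → p ∈ˡ allSubsets s
∈-allSubsets []          = hereˡ refl
∈-allSubsets (true ∷ p)  = ∈-++⁺ˡ (∈-map⁺ (true ∷_) (∈-allSubsets p))
∈-allSubsets {suc s} (false ∷ p) =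
  ∈-++⁺ʳ (List.map (true ∷_) (allSubsets s)) (∈-map⁺ (false ∷_) (∈-allSubsets p))

Ends : Fin n → Fin n × Fin n → Set
Ends v p = v ≡ proj₁ p ⊎ v ≡ proj₂ p

ends? : (v : Fin n) (p : Fin n × Fin n) → Dec (Ends v p)
ends? v p = (v Fin.≟ proj₁ p) ⊎-dec (v Fin.≟ proj₂ p)

disjoint⇒no-common-end : {v : Fin n} (p q : Fin n × Fin n) →
                         DisjointEdges p q → Ends v p → ¬ Ends v q
disjoint⇒no-common-end _ _ (d₁ , d₂ , d₃ , d₄) (inj₁ refl) (inj₁ e) = d₁ e
disjoint⇒no-common-end _ _ (d₁ , d₂ , d₃ , d₄) (inj₁ refl) (inj₂ e) = d₂ e
disjoint⇒no-common-end _ _ (d₁ , d₂ , d₃ , d₄) (inj₂ refl) (inj₁ e) = d₃ e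
disjoint⇒no-common-end _ _ (d₁ , d₂ , d₃ , d₄) (inj₂ refl) (inj₂ e) = d₄ e

same-endpoints : {a b c d : Fin n} → a Fin.< b → c Fin.< d →
                 Ends a (c , d) → Ends b (c , d) → (a , b) ≡ (c , d)
same-endpoints a<b c<d (inj₁ refl) (inj₁ refl) = ⊥-elim (Fin.<-irrefl refl a<b)
same-endpoints a<b c<d (inj₁ refl) (inj₂ refl) = refl
same-endpoints a<b c<d (inj₂ refl) (inj₁ refl) = ⊥-elim (Fin.<-asym a<b c<d)
same-endpoints a<b c<d (inj₂ refl) (inj₂ refl) = ⊥-elim (Fin.<-irrefl refl a<b)

-- Matchings and covered sets are stated for an arbitrary edge labelling
-- f, since the covered set is defined by recursion on the edge set.
Loopless : (Fin s → Fin n × Fin n) → Set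
Loopless f = ∀ e → proj₁ (f e) ≢ proj₂ (f e)

PairwiseDisjoint : (Fin s → Fin n × Fin n) → Subset s → Set
PairwiseDisjoint f ρ = ∀ {e g} → e ∈ ρ → g ∈ ρ → e ≢ g → DisjointEdges (f e) (f g)

endpoints : Fin n × Fin n → Subset n
endpoints p = ⁅ proj₁ p ⁆ ∪ ⁅ proj₂ p ⁆

∈-endpoints⁻ : (p : Fin n × Fin n) {v : Fin n} → v ∈ endpoints p → Ends v p
∈-endpoints⁻ p v∈ with x∈p∪q⁻ ⁅ proj₁ p ⁆ ⁅ proj₂ p ⁆ v∈
... | inj₁ i = inj₁ (x∈⁅y⁆⇒x≡y _ i)
... | inj₂ i = inj₂ (x∈⁅y⁆⇒x≡y _ i)

∣endpoints∣≡2 : (p : Fin n × Fin n) → proj₁ p ≢ proj₂ p → ∣ endpoints p ∣ ≡ 2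
∣endpoints∣≡2 (a , b) a≢b =
  trans (∣p∪q∣≡∣p∣+∣q∣ ⁅ a ⁆ ⁅ b ⁆ (λ i j → a≢b (trans (sym (x∈⁅y⁆⇒x≡y a i)) (x∈⁅y⁆⇒x≡y b j))))
        (cong₂ _+_ (∣⁅x⁆∣≡1 a) (∣⁅x⁆∣≡1 b))

covered : (Fin s → Fin n × Fin n) → Subset s → Subset n
covered f []          = ⊥
covered f (true ∷ ρ)  = endpoints (f zero) ∪ covered (f ∘ suc) ρ
covered f (false ∷ ρ) = covered (f ∘ suc) ρ

∈-covered⁻ : (f : Fin s → Fin n × Fin n) (ρ : Subset s) {v : Fin n} →
             v ∈ covered f ρ → ∃[ e ] (e ∈ ρ × Ends v (f e))
∈-covered⁻ f []          v∈ = ⊥-elim (∉⊥ v∈)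
∈-covered⁻ f (true ∷ ρ)  v∈ with x∈p∪q⁻ (endpoints (f zero)) _ v∈
... | inj₁ i = zero , here , ∈-endpoints⁻ (f zero) i
... | inj₂ i with ∈-covered⁻ (f ∘ suc) ρ i
...   | e , e∈ρ , v∈e = suc e , there e∈ρ , v∈e
∈-covered⁻ f (false ∷ ρ) v∈ with ∈-covered⁻ (f ∘ suc) ρ v∈
... | e , e∈ρ , v∈e = suc e , there e∈ρ , v∈e

∣covered∣ : (f : Fin s → Fin n × Fin n) (ρ : Subset s) → Loopless f →
            PairwiseDisjoint f ρ → ∣ covered f ρ ∣ ≡ 2 * ∣ ρ ∣
∣covered∣ {n = n} f [] _ _ = ∣⊥∣≡0 n
∣covered∣ f (false ∷ ρ) loopless disj =
  ∣covered∣ (f ∘ suc) ρ (loopless ∘ suc) (λ i j e≢g → disj (there i) (there j) (e≢g ∘ Fin.suc-injective))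
∣covered∣ f (true ∷ ρ) loopless disj = begin
  ∣ endpoints (f zero) ∪ covered (f ∘ suc) ρ ∣  ≡⟨ ∣p∪q∣≡∣p∣+∣q∣ _ _ first-apart ⟩
  ∣ endpoints (f zero) ∣ + ∣ covered (f ∘ suc) ρ ∣
    ≡⟨ cong₂ _+_ (∣endpoints∣≡2 (f zero) (loopless zero)) (∣covered∣ (f ∘ suc) ρ (loopless ∘ suc) rest-disj) ⟩
  2 + 2 * ∣ ρ ∣                                  ≡⟨ sym (ℕ.*-suc 2 ∣ ρ ∣) ⟩
  2 * suc ∣ ρ ∣                                  ∎
  where
  open ≡-Reasoning
  rest-disj : PairwiseDisjoint (f ∘ suc) ρ
  rest-disj i j e≢g = disj (there i) (there j) (e≢g ∘ Fin.suc-injective)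
  first-apart : ∀ {v} → v ∈ endpoints (f zero) → v ∉ covered (f ∘ suc) ρ
  first-apart v∈first v∈rest with ∈-covered⁻ (f ∘ suc) ρ v∈rest
  ... | e , e∈ρ , v∈e =
    disjoint⇒no-common-end (f zero) (f (suc e)) (disj here (there e∈ρ) (λ ())) (∈-endpoints⁻ _ v∈first) v∈e

module _ {n : ℕ} (G : Graph n) where

  loopless : Loopless (edge G)
  loopless e = Fin.<⇒≢ (ordered G e)

  matching-size : {ρ : Subset (m G)} → M G ρ → 2 * ∣ ρ ∣ ≤ n
  matching-size {ρ} mρ = subst (_≤ n) (∣covered∣ (edge G) ρ loopless mρ) (∣p∣≤n (covered (edge G) ρ))

  matching-downward : {ρ τ : Subset (m G)} → ρ ⊆ τ → M G τ → M G ρ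
  matching-downward ρ⊆τ mτ e∈ g∈ = mτ (ρ⊆τ e∈) (ρ⊆τ g∈)

  Perfect : Subset (m G) → Set
  Perfect τ = M G τ × 2 * ∣ τ ∣ ≡ n

  perfect-covers : {τ : Subset (m G)} → Perfect τ → (v : Fin n) → ∃[ e ] (e ∈ τ × Ends v (edge G e))
  perfect-covers {τ} (mτ , size) v = ∈-covered⁻ (edge G) τ (subst (v ∈_) (sym all-covered) ∈⊤)
    where
    all-covered : covered (edge G) τ ≡ ⊤
    all-covered = ∣p∣≡n⇒p≡⊤ (trans (∣covered∣ (edge G) τ loopless mτ) size)

  perfect-same-size : {τ τ′ : Subset (m G)} → Perfect τ → Perfect τ′ → ∣ τ ∣ ≡ ∣ τ′ ∣
  perfect-same-size (_ , size) (_ , size′) = ℕ.*-cancelˡ-≡ _ _ 2 (trans size (sym size′))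

  disjoint? : (p q : Fin n × Fin n) → Dec (DisjointEdges p q)
  disjoint? (a , b) (c , d) =
    ¬? (a Fin.≟ c) ×-dec ¬? (a Fin.≟ d) ×-dec ¬? (b Fin.≟ c) ×-dec ¬? (b Fin.≟ d)

  matching? : Decidable (M G)
  matching? ρ with Fin.all? (λ e → Fin.all? (λ g →
                     (e ∈? ρ) →-dec (g ∈? ρ) →-dec ¬? (e Fin.≟ g) →-dec disjoint? (edge G e) (edge G g)))
  ... | yes all-disjoint = yes (λ {e} {g} → all-disjoint e g)
  ... | no ¬all-disjoint = no (λ mρ → ¬all-disjoint (λ e g → mρ))

  perfect? : Decidable Perfect
  perfect? τ = matching? τ ×-dec (2 * ∣ τ ∣ ℕ.≟ n)

-- Collapsing along free pairs

record FreePair (K : Complex s) (σ τ : Subset s) : Set where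
  field
    face-σ       : K σ
    face-τ       : K τ
    σ⊆τ          : σ ⊆ τ
    one-up       : ∣ τ ∣ ≡ suc ∣ σ ∣
    only-cofaces : ∀ ρ → K ρ → σ ⊆ ρ → ρ ≡ σ ⊎ ρ ≡ τ

remove-free-pair : {K : Complex s} {σ τ : Subset s} → FreePair K σ τ →
                   ElementaryCollapse K (λ ρ → K ρ × ρ ≢ σ × ρ ≢ τ)
remove-free-pair {σ = σ} {τ} fp = σ , τ , face-σ , face-τ , σ⊆τ , one-up , only-cofaces , λ _ → id , id
  where open FreePair fp

restrict-free-pair : {K K′ : Complex s} {σ τ : Subset s} → (∀ ρ → K′ ρ → K ρ) →
                     K′ σ → K′ τ → FreePair K σ τ → FreePair K′ σ τ
restrict-free-pair K′⊆K K′σ K′τ fp = record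
  { face-σ = K′σ ; face-τ = K′τ ; σ⊆τ = σ⊆τ ; one-up = one-up
  ; only-cofaces = λ ρ K′ρ → only-cofaces ρ (K′⊆K ρ K′ρ) }
  where open FreePair fp

module CollapseFreePairs {s : ℕ} (K : Complex s) (Top : Subset s → Set)
  (σ : Subset s → Subset s)
  (free : ∀ {τ} → Top τ → FreePair K (σ τ) τ)
  (σ≢top : ∀ {τ τ′} → Top τ → Top τ′ → σ τ ≢ τ′) where

  -- K with the pairs (σ τ, τ) for τ ∈ P removed, the head of P last.
  Without : List (Subset s) → Complex s
  Without []      = K
  Without (τ ∷ P) ρ = Without P ρ × ρ ≢ σ τ × ρ ≢ τ

  Avoids : List (Subset s) → Subset s → Set
  Avoids P ρ = All (λ τ → ρ ≢ σ τ × ρ ≢ τ) P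

  without⇒face : ∀ P ρ → Without P ρ → K ρ
  without⇒face []      ρ Kρ       = Kρ
  without⇒face (τ ∷ P) ρ (w , _) = without⇒face P ρ w

  without⇒avoids : ∀ P ρ → Without P ρ → Avoids P ρ
  without⇒avoids []      ρ _            = []
  without⇒avoids (τ ∷ P) ρ (w , avoid) = avoid ∷ without⇒avoids P ρ w

  avoids⇒without : ∀ P ρ → K ρ → Avoids P ρ → Without P ρ
  avoids⇒without []      ρ Kρ []              = Kρ
  avoids⇒without (τ ∷ P) ρ Kρ (avoid ∷ avoids) = avoids⇒without P ρ Kρ avoids , avoid

  -- Distinct tops have distinct partners: σ τ ⊆ τ′ forces τ′ ∈ {σ τ, τ}.
  σ-injective : ∀ {τ τ′} → Top τ → Top τ′ → τ ≢ τ′ → σ τ ≢ σ τ′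
  σ-injective {τ} {τ′} t t′ τ≢τ′ eq
    with FreePair.only-cofaces (free t) τ′ (FreePair.face-τ (free t′))
           (subst (_⊆ τ′) (sym eq) (FreePair.σ⊆τ (free t′)))
  ... | inj₁ τ′≡στ = σ≢top t t′ (sym τ′≡στ)
  ... | inj₂ τ′≡τ  = τ≢τ′ (sym τ′≡τ)

  free-in-without : ∀ {τ} P → Top τ → All Top P → All (τ ≢_) P → FreePair (Without P) (σ τ) τ
  free-in-without {τ} P t tops distinct =
    restrict-free-pair (without⇒face P) (avoids⇒without P _ face-σ σ-avoids)
                       (avoids⇒without P _ face-τ τ-avoids) (free t)
    where
    open FreePair (free t)
    σ-avoids : Avoids P (σ τ)
    σ-avoids = All.zipWith (λ (t′ , τ≢τ′) → σ-injective t t′ τ≢τ′ , σ≢top t t′) (tops , distinct)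
    τ-avoids : Avoids P τ
    τ-avoids = All.zipWith (λ (t′ , τ≢τ′) → (λ eq → σ≢top t′ t (sym eq)) , τ≢τ′) (tops , distinct)

  collapse-all : ∀ P → All Top P → Unique P → Collapses K (Without P)
  collapse-all []      _            _                = ε
  collapse-all (τ ∷ P) (t ∷ tops) (distinct ∷ unique) =
    collapse-all P tops unique ◅◅ (remove-free-pair (free-in-without P t tops distinct) ◅ ε)

  collapse-tops : Decidable Top → Σ[ L ∈ Complex s ] (Collapses K L × (∀ ρ → L ρ → K ρ × ¬ Top ρ))
  collapse-tops top? = Without P , collapse-all P all-top (deduplicate-! (≡-dec Bool._≟_) listed) , remains
    where
    listed = List.filter top? (allSubsets s)
    P = deduplicate (≡-dec Bool._≟_) listed
    all-top : All Top P
    all-top = All.tabulate λ τ∈P →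
      proj₂ (∈-filter⁻ top? {xs = allSubsets s} (∈-deduplicate⁻ (≡-dec Bool._≟_) listed τ∈P))
    remains : ∀ ρ → Without P ρ → K ρ × ¬ Top ρ
    remains ρ w = without⇒face P ρ w , λ t →
      proj₂ (All.lookup (without⇒avoids P ρ w)
                        (∈-deduplicate⁺ (≡-dec Bool._≟_) (∈-filter⁺ top? (∈-allSubsets ρ) t))) refl

-- The free pair of a perfect matching

module _ {n : ℕ} (G : Graph n) (v : Fin n) where

  deleteAt : Subset (m G) → Subset (m G)
  deleteAt τ = τ ─ select (λ e → ends? v (edge G e))

  ∈-deleteAt⁻ : ∀ {τ x} → x ∈ deleteAt τ → x ∈ τ × ¬ Ends v (edge G x)
  ∈-deleteAt⁻ {τ} x∈ = p─q⊆p τ _ x∈ , x∈p─q⇒x∉q τ _ x∈ ∘ ∈-select⁺ (λ e → ends? v (edge G e))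

  ∈-deleteAt⁺ : ∀ {τ x} → x ∈ τ → ¬ Ends v (edge G x) → x ∈ deleteAt τ
  ∈-deleteAt⁺ x∈τ v∉x = x∈p∧x∉q⇒x∈p─q x∈τ (v∉x ∘ ∈-select⁻ (λ e → ends? v (edge G e)))

  module AtEdge {τ : Subset (m G)} (perfect : Perfect G τ)
                {e₀ : Fin (m G)} (e₀∈τ : e₀ ∈ τ) (v∈e₀ : Ends v (edge G e₀)) where

    -- Edges of τ other than e₀ avoid v, hence survive the deletion.
    others-kept : ∀ {x} → x ∈ τ → x ≢ e₀ → x ∈ deleteAt τ
    others-kept x∈τ x≢e₀ =
      ∈-deleteAt⁺ x∈τ (λ v∈x → disjoint⇒no-common-end _ _ (proj₁ perfect x∈τ e₀∈τ x≢e₀) v∈x v∈e₀)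

    deleteAt≡τ-e₀ : deleteAt τ ≡ τ - e₀
    deleteAt≡τ-e₀ = ⊆-antisym
      (λ x∈ → x∈p∧x≢y⇒x∈p-y (proj₁ (∈-deleteAt⁻ x∈)) (λ { refl → proj₂ (∈-deleteAt⁻ x∈) v∈e₀ }))
      (λ x∈ → others-kept (p─q⊆p τ _ x∈) (x∉⁅y⁆⇒x≢y (x∈p─q⇒x∉q τ _ x∈)))

    one-up : ∣ τ ∣ ≡ suc ∣ deleteAt τ ∣
    one-up = trans (∣p∣≡1+∣p-x∣ τ e₀∈τ) (cong (suc ∘ ∣_∣) (sym deleteAt≡τ-e₀))

    covered-off-e₀ : ∀ {u} → ¬ Ends u (edge G e₀) → ∃[ g ] (g ∈ deleteAt τ × Ends u (edge G g))
    covered-off-e₀ {u} u∉e₀ with perfect-covers G perfect u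
    ... | g , g∈τ , u∈g = g , others-kept g∈τ (λ { refl → u∉e₀ u∈g }) , u∈g

    -- A matching containing deleteAt τ can only add the edge e₀: any other
    -- endpoint would be shared with an edge of deleteAt τ.
    extension-is-e₀ : ∀ {ρ f} → M G ρ → deleteAt τ ⊆ ρ → f ∈ ρ → f ∉ deleteAt τ → f ≡ e₀
    extension-is-e₀ {ρ} {f} mρ σ⊆ρ f∈ρ f∉σ =
      injective G (same-endpoints (ordered G f) (ordered G e₀) (end-of-e₀ (inj₁ refl)) (end-of-e₀ (inj₂ refl)))
      where
      end-of-e₀ : ∀ {u} → Ends u (edge G f) → Ends u (edge G e₀)
      end-of-e₀ {u} u∈f = decidable-stable (ends? u (edge G e₀)) λ u∉e₀ →
        let (g , g∈σ , u∈g) = covered-off-e₀ u∉e₀ in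
        disjoint⇒no-common-end _ _ (mρ (σ⊆ρ g∈σ) f∈ρ (λ { refl → f∉σ g∈σ })) u∈g u∈f

    only-cofaces : ∀ ρ → M G ρ → deleteAt τ ⊆ ρ → ρ ≡ deleteAt τ ⊎ ρ ≡ τ
    only-cofaces ρ mρ σ⊆ρ with e₀ ∈? ρ
    ... | yes e₀∈ρ = inj₂ (⊆-antisym ρ⊆τ τ⊆ρ)
      where
      ρ⊆τ : ρ ⊆ τ
      ρ⊆τ {x} x∈ρ with x ∈? deleteAt τ
      ... | yes x∈σ = proj₁ (∈-deleteAt⁻ x∈σ)
      ... | no x∉σ  = subst (_∈ τ) (sym (extension-is-e₀ mρ σ⊆ρ x∈ρ x∉σ)) e₀∈τ
      τ⊆ρ : τ ⊆ ρ
      τ⊆ρ {x} x∈τ with x Fin.≟ e₀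
      ... | yes refl = e₀∈ρ
      ... | no x≢e₀  = σ⊆ρ (others-kept x∈τ x≢e₀)
    ... | no e₀∉ρ = inj₁ (⊆-antisym ρ⊆σ σ⊆ρ)
      where
      ρ⊆σ : ρ ⊆ deleteAt τ
      ρ⊆σ {x} x∈ρ with x ∈? deleteAt τ
      ... | yes x∈σ = x∈σ
      ... | no x∉σ  = ⊥-elim (e₀∉ρ (subst (_∈ ρ) (extension-is-e₀ mρ σ⊆ρ x∈ρ x∉σ) x∈ρ))

  perfect-free-pair : ∀ {τ} → Perfect G τ → FreePair (M G) (deleteAt τ) τ
  perfect-free-pair {τ} perfect with perfect-covers G perfect v
  ... | e₀ , e₀∈τ , v∈e₀ = record
    { face-σ = matching-downward G (p─q⊆p τ _) (proj₁ perfect)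
    ; face-τ = proj₁ perfect
    ; σ⊆τ = p─q⊆p τ _
    ; one-up = one-up
    ; only-cofaces = only-cofaces }
    where open AtEdge perfect e₀∈τ v∈e₀

  -- deleteAt τ is one edge short of perfect.
  deleteAt≢perfect : ∀ {τ τ′} → Perfect G τ → Perfect G τ′ → deleteAt τ ≢ τ′
  deleteAt≢perfect {τ} perfect perfect′ refl =
    ℕ.1+n≢n (trans (sym (FreePair.one-up (perfect-free-pair perfect))) (perfect-same-size G perfect perfect′))

collapse-perfect-matchings : {n : ℕ} (G : Graph n) → Fin n →
  Σ[ L ∈ Complex (m G) ] (Collapses (M G) L × (∀ ρ → L ρ → M G ρ × ¬ Perfect G ρ))
collapse-perfect-matchings G v =
  CollapseFreePairs.collapse-tops (M G) (Perfect G) (deleteAt G v)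
    (perfect-free-pair G v) (deleteAt≢perfect G v) (perfect? G)

lemma5p1 : (k : ℕ) → 1 ≤ k → (G : Graph (2 * k)) →
    Σ[ L ∈ Complex (m G) ] (Collapses (M G) L × HasDimAtMostMinus2 L k)
lemma5p1 zero    ()
lemma5p1 (suc k) _ G with collapse-perfect-matchings G zero
... | L , M↘L , non-perfect = L , M↘L , dimension
  where
  -- A face of L is a matching with at most k + 1 edges that is not perfect.
  dimension : HasDimAtMostMinus2 L (suc k)
  dimension ρ Lρ with non-perfect ρ Lρ
  ... | mρ , ¬perfect = ℕ.≤∧≢⇒< (ℕ.*-cancelˡ-≤ 2 (matching-size G mρ)) (λ size → ¬perfect (mρ , cong (2 *_) size))
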